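{- Let $s\ge 2$ and let $G=K(n_1,\dots,n_s)$ be a complete $s$-partite graph with parts $V_1,\dots,V_s$, where $n_1\ge n_2\ge\cdots\ge n_s$, $3\le n_1\le 5$ and $n_2=2$. Then there is an optimal $3$-relaxed coloring of $G$ (using $\chi_3(G)$ colors) which assigns the same color to three vertices of $V_1$ and to both vertices of $V_2$.
   Context: $K(n_1,\dots,n_s)$ denotes the complete $s$-partite graph whose parts $V_1,\dots,V_s$ have $n_1,\dots,n_s$ vertices. A $3$-relaxed $k$-coloring is a map $f:V\to\{1,\dots,k\}$ such that every vertex $u$ has at most $3$ neighbors $v$ with $f(v)=f(u)$; $\chi_3(G)$ is the minimum such $k$. -}

module Defs where

open import Data.Nat using (ℕ; zero; suc; _≤_)
open import Data.Fin using (Fin; zero; suc)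
open import Data.Fin.Properties using (_≟_)
open import Data.List using (List; length; filter; concatMap; map)
open import Data.List using () renaming (allFin to allFinL)
open import Data.Product using (Σ; _,_; proj₁; proj₂; _×_)
open import Relation.Nullary using (¬_; Dec; yes; no)
open import Relation.Nullary.Decidable using (_×-dec_; ¬?)
open import Relation.Binary.PropositionalEquality using (_≡_)

-- Complete s-partite graph K(n_0,...,n_{s-1}) with part sizes  n : Fin s → ℕ.
-- A vertex is a pair (i , j) : part index i, position j in part V_i.
Vertex : {s : ℕ} → (Fin s → ℕ) → Set
Vertex {s} n = Σ (Fin s) (λ i → Fin (n i))

Adj : {s : ℕ} (n : Fin s → ℕ) → Vertex n → Vertex n → Set
Adj n u v = ¬ (proj₁ u ≡ proj₁ v)

allVertices : {s : ℕ} (n : Fin s → ℕ) → List (Vertex n)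
allVertices {s} n = concatMap (λ i → map (λ j → (i , j)) (allFinL (n i))) (allFinL s)

sameColourNbrs : {s k : ℕ} (n : Fin s → ℕ) → (Vertex n → Fin k) → Vertex n → ℕ
sameColourNbrs n f u =
  length (filter (λ v → ¬? (proj₁ u ≟ proj₁ v) ×-dec (f v ≟ f u)) (allVertices n))

Relaxed3 : {s k : ℕ} (n : Fin s → ℕ) → (Vertex n → Fin k) → Set
Relaxed3 n f = ∀ u → sameColourNbrs n f u ≤ 3

Optimal3 : {s : ℕ} (n : Fin s → ℕ) (k : ℕ) → (Vertex n → Fin k) → Set
Optimal3 n k f = Relaxed3 n f × (∀ k' → (g : Vertex n → Fin k') → Relaxed3 n g → k ≤ k')

module Submission where

-- Parts are indexed from 0 here: V₀ is the large part and V₁ the part with two vertices.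
-- If a colour class C of a 3-relaxed colouring meets Vᵢ, a vertex of C ∩ Vᵢ is adjacent to
-- all of C outside Vᵢ, so |C| ≤ 3 + |C ∩ Vᵢ|. Hence 3|C| ≤ 12 + |C ∩ V₀|: this is clear if
-- C ⊆ V₀ (as n₀ ≤ 5); otherwise C meets a part of size at most 2, so |C| ≤ 5, and |C| = 5
-- with |C ∩ V₀| ≤ 2 is impossible: every part would meet C in 0 or 2 vertices, so |C| is even.
-- Summing over the k classes, 3|V| ≤ 12k + n₀ ≤ 12k + 5, i.e. k ≥ 1 + ⌈(|V| − 5)/4⌉. That many
-- colours suffice: one colour for three vertices of V₀ together with V₁, and the remaining
-- |V| − 5 vertices, listed part by part, cut into consecutive blocks of four.

open import Defs
open import Data.Nat using (ℕ; zero; suc; _+_; _*_; _∸_; _/_; _≤_; _<_; _≥_; z≤n; s≤s)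
open import Data.Nat.Properties
  using ( +-*-semiring; _≤?_; ≤-refl; ≤-trans; ≤-reflexive; ≤-antisym; ≰⇒>; m≤m+n; m≤n+m
        ; +-mono-≤; +-monoʳ-≤; +-monoˡ-≤; +-cancelʳ-≤; *-monoʳ-≤
        ; +-identityʳ; *-identityʳ; +-comm; +-assoc; +-suc )
import Data.Nat.Properties as ℕ
open import Data.Nat.DivMod using (m<n*o⇒m/o<n; m*n/n≡m; /-monoˡ-≤; m/n≡1+[m∸n]/n)
open import Data.Nat.Divisibility using (_∣_; _∣?_; ∣m∣n⇒∣m+n; _∣0; n∣n)
open import Algebra.Properties.Semiring.Sum +-*-semiring
  using (sum; sum-syntax; sum-cong-≗; sum-replicate-zero; ∑-distrib-+; ∑-comm; *-distribˡ-sum)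
open import Data.Fin using (Fin; zero; suc; toℕ; fromℕ<; inject≤)
import Data.Fin
open import Data.Fin.Properties using (_≟_; toℕ<n; toℕ-fromℕ<; toℕ-injective; toℕ-inject≤; inject≤-injective)
open import Data.List using (List; _++_; length; filter; map; tabulate; concatMap; allFin)
open import Data.List.Properties using (length-++; filter-++; map-tabulate)
open import Data.Bool using (if_then_else_)
open import Data.Nat.Tactic.RingSolver using (solve-∀)
open import Function using (_∘_)
open import Data.Product using (Σ; ∃; _,_; _×_; proj₁)
open import Data.Sum using (_⊎_; inj₁; inj₂)
open import Data.Empty using (⊥-elim)
open import Relation.Nullary using (¬_; Dec; yes; no; does)
open import Relation.Nullary.Decidable using (¬?; _×-dec_; from-no)
open import Relation.Binary.PropositionalEquality using (_≡_; refl; sym; trans; cong; cong₂; subst; subst₂; module ≡-Reasoning)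

𝟙 : {P : Set} → Dec P → ℕ
𝟙 p = if does p then 1 else 0

𝟙-cong : {P Q : Set} → (P → Q) → (Q → P) → (p : Dec P) (q : Dec Q) → 𝟙 p ≡ 𝟙 q
𝟙-cong P→Q Q→P (yes _) (yes _) = refl
𝟙-cong P→Q Q→P (yes p) (no ¬q) = ⊥-elim (¬q (P→Q p))
𝟙-cong P→Q Q→P (no ¬p) (yes q) = ⊥-elim (¬p (Q→P q))
𝟙-cong P→Q Q→P (no _) (no _) = refl

𝟙≤1 : {P : Set} (p : Dec P) → 𝟙 p ≤ 1
𝟙≤1 (yes _) = ≤-refl
𝟙≤1 (no _) = z≤n

𝟙-positive : {P : Set} (p : Dec P) → 1 ≤ 𝟙 p → P
𝟙-positive (yes p) _ = p

𝟙-no : {P : Set} (p : Dec P) → ¬ P → 𝟙 p ≡ 0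
𝟙-no (yes p) ¬p = ⊥-elim (¬p p)
𝟙-no (no _) _ = refl

𝟙-yes : {P : Set} (p : Dec P) → P → 𝟙 p ≡ 1
𝟙-yes (yes _) _ = refl
𝟙-yes (no ¬p) p = ⊥-elim (¬p p)

∑-const : ∀ k x → ∑[ i < k ] x ≡ k * x
∑-const zero x = refl
∑-const (suc k) x = cong (x +_) (∑-const k x)

∑-ones : ∀ k → ∑[ i < k ] 1 ≡ k
∑-ones k = trans (∑-const k 1) (*-identityʳ k)

∑-mono-≤ : ∀ {k} {f g : Fin k → ℕ} → (∀ i → f i ≤ g i) → sum f ≤ sum g
∑-mono-≤ {zero} f≤g = z≤n
∑-mono-≤ {suc k} f≤g = +-mono-≤ (f≤g zero) (∑-mono-≤ (λ i → f≤g (suc i)))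

term≤∑ : ∀ {k} (f : Fin k → ℕ) i → f i ≤ sum f
term≤∑ f zero = m≤m+n (f zero) _
term≤∑ f (suc i) = ≤-trans (term≤∑ (λ i → f (suc i)) i) (m≤n+m _ (f zero))

∑-δ : ∀ {k} (i : Fin k) (f : Fin k → ℕ) → ∑[ i′ < k ] (if does (i ≟ i′) then f i′ else 0) ≡ f i
∑-δ {suc k} zero f = trans (cong (f zero +_) (sum-replicate-zero k)) (+-identityʳ (f zero))
∑-δ (suc i) f = ∑-δ i (λ i′ → f (suc i′))

∑≡0⊎positive : ∀ {k} (f : Fin k → ℕ) → sum f ≡ 0 ⊎ ∃ λ i → 1 ≤ f i
∑≡0⊎positive {zero} f = inj₁ refl
∑≡0⊎positive {suc k} f with f zero in f₀≡ | ∑≡0⊎positive (λ i → f (suc i))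
... | suc _ | _ = inj₂ (zero , subst (1 ≤_) (sym f₀≡) (s≤s z≤n))
... | zero | inj₁ tail≡0 = inj₁ tail≡0
... | zero | inj₂ (i , fᵢ≥1) = inj₂ (suc i , fᵢ≥1)

∑-∣ : ∀ {k} d (f : Fin k → ℕ) → (∀ i → d ∣ f i) → d ∣ sum f
∑-∣ {zero} d f d∣f = d ∣0
∑-∣ {suc k} d f d∣f = ∣m∣n⇒∣m+n (d∣f zero) (∑-∣ d (λ i → f (suc i)) (λ i → d∣f (suc i)))

∑𝟙-witness : ∀ {m} {P : Fin m → Set} (P? : ∀ j → Dec (P j)) → 1 ≤ ∑[ j < m ] 𝟙 (P? j) → ∃ P
∑𝟙-witness P? ∑≥1 with ∑≡0⊎positive (λ j → 𝟙 (P? j))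
... | inj₁ ∑≡0 = ⊥-elim (ℕ.<⇒≢ ∑≥1 (sym ∑≡0))
... | inj₂ (j , 𝟙≥1) = j , 𝟙-positive (P? j) 𝟙≥1

∑𝟙≤ : ∀ {m} {P : Fin m → Set} (P? : ∀ j → Dec (P j)) → ∑[ j < m ] 𝟙 (P? j) ≤ m
∑𝟙≤ {m} P? = ≤-trans (∑-mono-≤ (λ j → 𝟙≤1 (P? j))) (≤-reflexive (∑-ones m))

module _ {A : Set} {P : A → Set} (P? : ∀ x → Dec (P x)) where

  count-tabulate : ∀ {m} (h : Fin m → A) → length (filter P? (tabulate h)) ≡ ∑[ j < m ] 𝟙 (P? (h j))
  count-tabulate {zero} h = refl
  count-tabulate {suc m} h with P? (h zero)
  ... | yes _ = cong suc (count-tabulate (λ j → h (suc j)))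
  ... | no _ = count-tabulate (λ j → h (suc j))

  count-concatMap : ∀ {B : Set} {s} (F : B → List A) (h : Fin s → B) →
    length (filter P? (concatMap F (tabulate h))) ≡ ∑[ i < s ] length (filter P? (F (h i)))
  count-concatMap {s = zero} F h = refl
  count-concatMap {s = suc s} F h = begin
    length (filter P? (F (h zero) ++ concatMap F (tabulate (λ i → h (suc i)))))
      ≡⟨ cong length (filter-++ P? (F (h zero)) _) ⟩
    length (filter P? (F (h zero)) ++ filter P? (concatMap F (tabulate (λ i → h (suc i)))))
      ≡⟨ length-++ (filter P? (F (h zero))) ⟩
    length (filter P? (F (h zero))) + length (filter P? (concatMap F (tabulate (λ i → h (suc i)))))
      ≡⟨ cong (length (filter P? (F (h zero))) +_) (count-concatMap F (λ i → h (suc i))) ⟩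
    ∑[ i < suc s ] length (filter P? (F (h i))) ∎
    where open ≡-Reasoning

count-allVertices : ∀ {s} (n : Fin s → ℕ) {P : Vertex n → Set} (P? : ∀ v → Dec (P v)) →
  length (filter P? (allVertices n)) ≡ ∑[ i < s ] ∑[ j < n i ] 𝟙 (P? (i , j))
count-allVertices n P? =
  trans (count-concatMap P? (λ i → map (λ j → (i , j)) (allFin (n i))) (λ i → i))
        (sum-cong-≗ λ i → trans (cong (λ xs → length (filter P? xs)) (map-tabulate (λ j → j) (λ j → (i , j))))
                                (count-tabulate P? (λ j → (i , j))))

module ColourClasses {s k : ℕ} (n : Fin s → ℕ) (f : Vertex n → Fin k) where

  partCount : Fin s → Fin k → ℕ
  partCount i c = ∑[ j < n i ] 𝟙 (f (i , j) ≟ c)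

  classSize : Fin k → ℕ
  classSize c = ∑[ i < s ] partCount i c

  partCount≤ : ∀ i c → partCount i c ≤ n i
  partCount≤ i c = ∑𝟙≤ (λ j → f (i , j) ≟ c)

  partCount-own : ∀ i j → 1 ≤ partCount i (f (i , j))
  partCount-own i j = subst (_≤ partCount i (f (i , j))) (𝟙-yes (f (i , j) ≟ f (i , j)) refl)
    (term≤∑ (λ j′ → 𝟙 (f (i , j′) ≟ f (i , j))) j)

  ∑-partCount : ∀ i → ∑[ c < k ] partCount i c ≡ n i
  ∑-partCount i = begin
    ∑[ c < k ] ∑[ j < n i ] 𝟙 (f (i , j) ≟ c)  ≡⟨ ∑-comm (λ c j → 𝟙 (f (i , j) ≟ c)) ⟩
    ∑[ j < n i ] ∑[ c < k ] 𝟙 (f (i , j) ≟ c)  ≡⟨ sum-cong-≗ (λ j → ∑-δ (f (i , j)) (λ _ → 1)) ⟩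
    ∑[ j < n i ] 1                              ≡⟨ ∑-ones (n i) ⟩
    n i                                         ∎
    where open ≡-Reasoning

  ∑-classSize : ∑[ c < k ] classSize c ≡ ∑[ i < s ] n i
  ∑-classSize = trans (∑-comm (λ c i → partCount i c)) (sum-cong-≗ ∑-partCount)

  sameColourNbrs+partCount≡classSize : ∀ i j →
    sameColourNbrs n f (i , j) + partCount i (f (i , j)) ≡ classSize (f (i , j))
  sameColourNbrs+partCount≡classSize i j = begin
    sameColourNbrs n f (i , j) + partCount i c
      ≡⟨ cong₂ _+_ (count-allVertices n (λ v → ¬? (i ≟ proj₁ v) ×-dec (f v ≟ c)))
                   (sym (∑-δ i (λ i′ → partCount i′ c))) ⟩
    sum otherParts + sum ownPart
      ≡⟨ sym (∑-distrib-+ otherParts ownPart) ⟩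
    ∑[ i′ < s ] (otherParts i′ + ownPart i′)
      ≡⟨ sum-cong-≗ split ⟩
    classSize c ∎
    where
    open ≡-Reasoning
    c = f (i , j)
    otherParts ownPart : Fin s → ℕ
    otherParts i′ = ∑[ j′ < n i′ ] 𝟙 (¬? (i ≟ i′) ×-dec (f (i′ , j′) ≟ c))
    ownPart i′ = if does (i ≟ i′) then partCount i′ c else 0
    split : ∀ i′ → otherParts i′ + ownPart i′ ≡ partCount i′ c
    split i′ with i ≟ i′
    ... | yes _ = cong (_+ partCount i′ c) (sum-replicate-zero (n i′))
    ... | no _ = +-identityʳ (partCount i′ c)

  relaxed⇒classSize≤ : Relaxed3 n f → ∀ i c → 1 ≤ partCount i c → classSize c ≤ 3 + partCount i c
  relaxed⇒classSize≤ relaxed i c partCount≥1 with ∑𝟙-witness (λ j → f (i , j) ≟ c) partCount≥1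
  ... | j , refl = subst (_≤ 3 + partCount i c) (sameColourNbrs+partCount≡classSize i j)
                     (+-monoˡ-≤ (partCount i c) (relaxed (i , j)))

  classSize≤⇒relaxed : (∀ i j → classSize (f (i , j)) ≤ 3 + partCount i (f (i , j))) → Relaxed3 n f
  classSize≤⇒relaxed bound (i , j) = +-cancelʳ-≤ (partCount i (f (i , j))) _ 3
    (subst (_≤ 3 + partCount i (f (i , j))) (sym (sameColourNbrs+partCount≡classSize i j)) (bound i j))

2∣-≤2-≢1 : ∀ {x} → x ≤ 2 → ¬ x ≡ 1 → 2 ∣ x
2∣-≤2-≢1 {0} _ _ = 2 ∣0
2∣-≤2-≢1 {1} _ x≢1 = ⊥-elim (x≢1 refl)
2∣-≤2-≢1 {2} _ _ = n∣n
2∣-≤2-≢1 {suc (suc (suc _))} (s≤s (s≤s ())) _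

3x≤12+x : ∀ {x} → x ≤ 6 → 3 * x ≤ 12 + x
3x≤12+x {x} x≤6 = ≤-trans (≤-reflexive (+-comm x (2 * x))) (+-monoˡ-≤ x (*-monoʳ-≤ 2 x≤6))

-- w i is the number of vertices of one colour class in part i; the last hypothesis
-- is the relaxedness of that class.
colourClassBound : ∀ {s} (w : Fin (suc s) → ℕ) → w zero ≤ 6 → (∀ i → w (suc i) ≤ 2) →
  (∀ i → 1 ≤ w i → sum w ≤ 3 + w i) → 3 * sum w ≤ 12 + w zero
colourClassBound w w₀≤6 wₛ≤2 tight with ∑≡0⊎positive (λ i → w (suc i))
... | inj₁ tail≡0 = subst (λ S → 3 * S ≤ 12 + w zero)
        (sym (trans (cong (w zero +_) tail≡0) (+-identityʳ (w zero)))) (3x≤12+x w₀≤6)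
... | inj₂ (i , wᵢ≥1) = sharedClassBound (≤-trans (tight (suc i) wᵢ≥1) (+-monoʳ-≤ 3 (wₛ≤2 i)))
  where
  sharedClassBound : sum w ≤ 5 → 3 * sum w ≤ 12 + w zero
  sharedClassBound S≤5 with sum w ≤? 4 | 3 ≤? w zero
  ... | yes S≤4 | _ = ≤-trans (*-monoʳ-≤ 3 S≤4) (m≤m+n 12 (w zero))
  ... | no _ | yes w₀≥3 = ≤-trans (*-monoʳ-≤ 3 S≤5) (+-monoʳ-≤ 12 w₀≥3)
  ... | no S≰4 | no w₀≱3 = ⊥-elim (from-no (2 ∣? 5) (subst (2 ∣_) S≡5 (∑-∣ 2 w 2∣w)))
    where
    S≡5 : sum w ≡ 5
    S≡5 = ≤-antisym S≤5 (≰⇒> S≰4)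
    w≤2 : ∀ j → w j ≤ 2
    w≤2 zero = ℕ.≤-pred (≰⇒> w₀≱3)
    w≤2 (suc j) = wₛ≤2 j
    w≢1 : ∀ j → ¬ w j ≡ 1
    w≢1 j wⱼ≡1 = ℕ.<-irrefl refl (subst₂ _≤_ S≡5 (cong (3 +_) wⱼ≡1) (tight j (≤-reflexive (sym wⱼ≡1))))
    2∣w : ∀ j → 2 ∣ w j
    2∣w j = 2∣-≤2-≢1 (w≤2 j) (w≢1 j)

relaxed-lowerBound : ∀ {s k} (n : Fin (suc s) → ℕ) → n zero ≤ 6 → (∀ i → n (suc i) ≤ 2) →
  (f : Vertex n → Fin k) → Relaxed3 n f → 3 * ∑[ i < suc s ] n i ≤ k * 12 + n zero
relaxed-lowerBound {s} {k} n n₀≤6 nₛ≤2 f relaxed = begin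
  3 * ∑[ i < suc s ] n i                       ≡⟨ cong (3 *_) (sym ∑-classSize) ⟩
  3 * ∑[ c < k ] classSize c                   ≡⟨ *-distribˡ-sum 3 classSize ⟩
  ∑[ c < k ] (3 * classSize c)                 ≤⟨ ∑-mono-≤ perColour ⟩
  ∑[ c < k ] (12 + partCount zero c)           ≡⟨ ∑-distrib-+ (λ _ → 12) (partCount zero) ⟩
  ∑[ c < k ] 12 + ∑[ c < k ] partCount zero c  ≡⟨ cong₂ _+_ (∑-const k 12) (∑-partCount zero) ⟩
  k * 12 + n zero                              ∎
  where
  open ℕ.≤-Reasoning
  open ColourClasses n f
  perColour : ∀ c → 3 * classSize c ≤ 12 + partCount zero c
  perColour c = colourClassBound (λ i → partCount i c)
    (≤-trans (partCount≤ zero c) n₀≤6) (λ i → ≤-trans (partCount≤ (suc i) c) (nₛ≤2 i))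
    (λ i → relaxed⇒classSize≤ relaxed i c)

3[R+5]≤12k+5⇒1+[R+3]/4≤k : ∀ R k → 3 * (R + 5) ≤ k * 12 + 5 → suc ((R + 3) / 4) ≤ k
3[R+5]≤12k+5⇒1+[R+3]/4≤k R k bound = m<n*o⇒m/o<n (ℕ.≤-pred (ℕ.*-cancelˡ-< 3 _ _ scaled))
  where
  lhs : ∀ R → 3 * (R + 5) ≡ 2 + suc (3 * suc (R + 3))
  lhs = solve-∀
  rhs : ∀ k → k * 12 + 5 ≡ 2 + 3 * suc (k * 4)
  rhs = solve-∀
  scaled : 3 * suc (R + 3) < 3 * suc (k * 4)
  scaled = ℕ.+-cancelˡ-≤ 2 _ _ (subst₂ _≤_ (lhs R) (rhs k) bound)

intervalSum : (ℕ → ℕ) → ℕ → ℕ → ℕ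
intervalSum f b zero = 0
intervalSum f b (suc L) = f b + intervalSum f (suc b) L

intervalSum-fin : ∀ f b L → ∑[ j < L ] f (b + toℕ j) ≡ intervalSum f b L
intervalSum-fin f b zero = refl
intervalSum-fin f b (suc L) = cong₂ _+_ (cong f (+-identityʳ b))
  (trans (sum-cong-≗ {L} (λ j → cong f (+-suc b (toℕ j)))) (intervalSum-fin f (suc b) L))

intervalSum-++ : ∀ f b L₁ L₂ → intervalSum f b (L₁ + L₂) ≡ intervalSum f b L₁ + intervalSum f (b + L₁) L₂
intervalSum-++ f b zero L₂ = cong (λ b′ → intervalSum f b′ L₂) (sym (+-identityʳ b))
intervalSum-++ f b (suc L₁) L₂ = begin
  f b + intervalSum f (suc b) (L₁ + L₂)
    ≡⟨ cong (f b +_) (intervalSum-++ f (suc b) L₁ L₂) ⟩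
  f b + (intervalSum f (suc b) L₁ + intervalSum f (suc b + L₁) L₂)
    ≡⟨ sym (+-assoc (f b) _ _) ⟩
  f b + intervalSum f (suc b) L₁ + intervalSum f (suc b + L₁) L₂
    ≡⟨ cong (λ b′ → f b + intervalSum f (suc b) L₁ + intervalSum f b′ L₂) (sym (+-suc b L₁)) ⟩
  f b + intervalSum f (suc b) L₁ + intervalSum f (b + suc L₁) L₂ ∎
  where open ≡-Reasoning

intervalSum-shift : ∀ f a b L → intervalSum f (a + b) L ≡ intervalSum (λ p → f (a + p)) b L
intervalSum-shift f a b zero = refl
intervalSum-shift f a b (suc L) = cong (f (a + b) +_)
  (trans (cong (λ b′ → intervalSum f b′ L) (sym (+-suc a b))) (intervalSum-shift f a (suc b) L))

intervalSum-mono : ∀ f b {L L′} → L ≤ L′ → intervalSum f b L ≤ intervalSum f b L′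
intervalSum-mono f b z≤n = z≤n
intervalSum-mono f b (s≤s L≤L′) = +-monoʳ-≤ (f b) (intervalSum-mono f (suc b) L≤L′)

intervalSum-zero : ∀ f b L → (∀ p → b ≤ p → p < b + L → f p ≡ 0) → intervalSum f b L ≡ 0
intervalSum-zero f b zero _ = refl
intervalSum-zero f b (suc L) vanish = cong₂ _+_
  (vanish b ≤-refl (ℕ.m<m+n b (s≤s z≤n)))
  (intervalSum-zero f (suc b) L (λ p b<p p<b+L →
    vanish p (ℕ.<⇒≤ b<p) (subst (p <_) (sym (+-suc b L)) p<b+L)))

intervalSum≤length : ∀ f b L → (∀ p → f p ≤ 1) → intervalSum f b L ≤ L
intervalSum≤length f b zero _ = z≤n
intervalSum≤length f b (suc L) f≤1 = +-mono-≤ (f≤1 b) (intervalSum≤length f (suc b) L f≤1)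

blockSize≤4 : ∀ d L → intervalSum (λ p → 𝟙 (p / 4 ℕ.≟ d)) 0 L ≤ 4
blockSize≤4 d L = begin
  intervalSum B 0 L
    ≤⟨ intervalSum-mono B 0 (≤-trans (m≤n+m L 4) (m≤n+m (4 + L) (d * 4))) ⟩
  intervalSum B 0 (d * 4 + (4 + L))
    ≡⟨ intervalSum-++ B 0 (d * 4) (4 + L) ⟩
  intervalSum B 0 (d * 4) + intervalSum B (d * 4) (4 + L)
    ≡⟨ cong₂ _+_ (intervalSum-zero B 0 (d * 4) below) (intervalSum-++ B (d * 4) 4 L) ⟩
  intervalSum B (d * 4) 4 + intervalSum B (d * 4 + 4) L
    ≡⟨ cong (intervalSum B (d * 4) 4 +_) (intervalSum-zero B (d * 4 + 4) L above) ⟩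
  intervalSum B (d * 4) 4 + 0
    ≤⟨ +-monoˡ-≤ 0 (intervalSum≤length B (d * 4) 4 (λ p → 𝟙≤1 (p / 4 ℕ.≟ d))) ⟩
  4 ∎
  where
  open ℕ.≤-Reasoning
  B : ℕ → ℕ
  B p = 𝟙 (p / 4 ℕ.≟ d)
  below : ∀ p → 0 ≤ p → p < d * 4 → B p ≡ 0
  below p _ p<4d = 𝟙-no (p / 4 ℕ.≟ d) (ℕ.<⇒≢ (m<n*o⇒m/o<n p<4d))
  above : ∀ p → d * 4 + 4 ≤ p → p < d * 4 + 4 + L → B p ≡ 0
  above p 4d+4≤p _ = 𝟙-no (p / 4 ℕ.≟ d) (λ p/4≡d → ℕ.<⇒≢ (subst (_≤ p / 4) (m*n/n≡m (suc d) 4)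
    (/-monoˡ-≤ 4 (subst (_≤ p) (+-comm (d * 4) 4) 4d+4≤p))) (sym p/4≡d))

prefixSum : ∀ {t} → (Fin t → ℕ) → Fin t → ℕ
prefixSum m zero = 0
prefixSum m (suc i) = m zero + prefixSum (λ i′ → m (suc i′)) i

prefixSum+term≤∑ : ∀ {t} (m : Fin t → ℕ) i → prefixSum m i + m i ≤ sum m
prefixSum+term≤∑ m zero = m≤m+n (m zero) _
prefixSum+term≤∑ m (suc i) = ≤-trans (≤-reflexive (+-assoc (m zero) _ _))
  (+-monoʳ-≤ (m zero) (prefixSum+term≤∑ (λ i′ → m (suc i′)) i))

intervalSum-tiling : ∀ f {t} (m : Fin t → ℕ) b →
  ∑[ i < t ] intervalSum f (b + prefixSum m i) (m i) ≡ intervalSum f b (sum m)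
intervalSum-tiling f {zero} m b = refl
intervalSum-tiling f {suc t} m b = begin
  intervalSum f (b + 0) (m zero) + ∑[ i < t ] intervalSum f (b + (m zero + prefixSum m′ i)) (m′ i)
    ≡⟨ cong₂ _+_ (cong (λ b′ → intervalSum f b′ (m zero)) (+-identityʳ b))
                 (sum-cong-≗ (λ i → cong (λ b′ → intervalSum f b′ (m′ i)) (sym (+-assoc b (m zero) _)))) ⟩
  intervalSum f b (m zero) + ∑[ i < t ] intervalSum f (b + m zero + prefixSum m′ i) (m′ i)
    ≡⟨ cong (intervalSum f b (m zero) +_) (intervalSum-tiling f m′ (b + m zero)) ⟩
  intervalSum f b (m zero) + intervalSum f (b + m zero) (sum m′)
    ≡⟨ sym (intervalSum-++ f b (m zero) (sum m′)) ⟩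
  intervalSum f b (sum m) ∎
  where
  open ≡-Reasoning
  m′ : Fin t → ℕ
  m′ i = m (suc i)

-- Colour 0 goes to the vertices 0, 1, 2 of V₀ and to V₁. The other R vertices are numbered
-- 0, …, R − 1 (first the rest of V₀, then V₂, V₃, … in order) and number p gets colour 1 + p / 4.
headColour : ℕ → ℕ
headColour 0 = 0
headColour 1 = 0
headColour 2 = 0
headColour (suc (suc (suc p))) = suc (p / 4)

module BlockColouring (t : ℕ) (n : Fin (suc (suc t)) → ℕ) (3≤n₀ : 3 ≤ n zero) (n₁≡2 : n (suc zero) ≡ 2) where

  A : ℕ
  A = n zero ∸ 3

  m : Fin t → ℕ
  m i = n (suc (suc i))

  R : ℕ
  R = A + sum m

  K : ℕ
  K = suc ((R + 3) / 4)

  n₀≡3+A : n zero ≡ 3 + A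
  n₀≡3+A = sym (ℕ.m+[n∸m]≡n 3≤n₀)

  colourℕ : Vertex n → ℕ
  colourℕ (zero , j) = headColour (toℕ j)
  colourℕ (suc zero , j) = 0
  colourℕ (suc (suc i) , j) = suc ((A + prefixSum m i + toℕ j) / 4)

  block<K : ∀ {p} → p < R → suc (p / 4) < K
  block<K {p} p<R = s≤s (subst (_≤ (R + 3) / 4) [p+4]/4≡1+p/4 (/-monoˡ-≤ 4 p+4≤R+3))
    where
    [p+4]/4≡1+p/4 : (p + 4) / 4 ≡ suc (p / 4)
    [p+4]/4≡1+p/4 = trans (m/n≡1+[m∸n]/n (m≤n+m 4 p)) (cong (λ q → suc (q / 4)) (ℕ.m+n∸n≡m p 4))
    p+4≤R+3 : p + 4 ≤ R + 3
    p+4≤R+3 = subst (_≤ R + 3) (sym (+-suc p 3)) (+-monoˡ-≤ 3 p<R)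

  colourℕ<K : ∀ v → colourℕ v < K
  colourℕ<K (zero , j) = head<K (toℕ j) (subst (toℕ j <_) n₀≡3+A (toℕ<n j))
    where
    head<K : ∀ p → p < 3 + A → headColour p < K
    head<K 0 _ = s≤s z≤n
    head<K 1 _ = s≤s z≤n
    head<K 2 _ = s≤s z≤n
    head<K (suc (suc (suc p))) (s≤s (s≤s (s≤s p<A))) = block<K (≤-trans p<A (m≤m+n A (sum m)))
  colourℕ<K (suc zero , j) = s≤s z≤n
  colourℕ<K (suc (suc i) , j) = block<K (begin-strict
    A + prefixSum m i + toℕ j    ≡⟨ +-assoc A (prefixSum m i) (toℕ j) ⟩
    A + (prefixSum m i + toℕ j)  <⟨ ℕ.+-monoʳ-< A (ℕ.+-monoʳ-< (prefixSum m i) (toℕ<n j)) ⟩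
    A + (prefixSum m i + m i)    ≤⟨ +-monoʳ-≤ A (prefixSum+term≤∑ m i) ⟩
    R                            ∎)
    where open ℕ.≤-Reasoning

  colouring : Vertex n → Fin K
  colouring v = fromℕ< (colourℕ<K v)

  toℕ-colouring : ∀ v → toℕ (colouring v) ≡ colourℕ v
  toℕ-colouring v = toℕ-fromℕ< (colourℕ<K v)

  open ColourClasses n colouring

  partCountℕ : Fin (suc (suc t)) → ℕ → ℕ
  partCountℕ i x = ∑[ j < n i ] 𝟙 (colourℕ (i , j) ℕ.≟ x)

  partCount≡partCountℕ : ∀ i c → partCount i c ≡ partCountℕ i (toℕ c)
  partCount≡partCountℕ i c = sum-cong-≗ λ j → 𝟙-cong
    (λ e → trans (sym (toℕ-colouring (i , j))) (cong toℕ e))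
    (λ e → toℕ-injective (trans (toℕ-colouring (i , j)) e))
    (colouring (i , j) ≟ c) (colourℕ (i , j) ℕ.≟ toℕ c)

  partCountℕ-own : ∀ i j → 1 ≤ partCountℕ i (colourℕ (i , j))
  partCountℕ-own i j = subst (1 ≤_)
    (trans (partCount≡partCountℕ i _) (cong (partCountℕ i) (toℕ-colouring (i , j)))) (partCount-own i j)

  classSizeℕ : ℕ → ℕ
  classSizeℕ x = ∑[ i < suc (suc t) ] partCountℕ i x

  classSize≡classSizeℕ : ∀ c → classSize c ≡ classSizeℕ (toℕ c)
  classSize≡classSizeℕ c = sum-cong-≗ (λ i → partCount≡partCountℕ i c)

  headPartCount : ∀ x → partCountℕ zero x ≡ intervalSum (λ p → 𝟙 (headColour p ℕ.≟ x)) 0 (3 + A)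
  headPartCount x = trans (intervalSum-fin h 0 (n zero)) (cong (intervalSum h 0) n₀≡3+A)
    where
    h : ℕ → ℕ
    h p = 𝟙 (headColour p ℕ.≟ x)

  blockClassSize≤4 : ∀ d → classSizeℕ (suc d) ≤ 4
  blockClassSize≤4 d = begin
    partCountℕ zero (suc d) + (partCountℕ (suc zero) (suc d) + ∑[ i < t ] partCountℕ (suc (suc i)) (suc d))
      ≡⟨ cong₂ _+_ head (cong₂ _+_ (sum-replicate-zero (n (suc zero))) rest) ⟩
    intervalSum B 0 A + (0 + intervalSum B A (sum m))
      ≡⟨ sym (intervalSum-++ B 0 A (sum m)) ⟩
    intervalSum B 0 R
      ≤⟨ blockSize≤4 d R ⟩
    4 ∎
    where
    open ℕ.≤-Reasoning
    B : ℕ → ℕ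
    B p = 𝟙 (p / 4 ℕ.≟ d)
    head : partCountℕ zero (suc d) ≡ intervalSum B 0 A
    head = trans (headPartCount (suc d)) (intervalSum-shift _ 3 0 A)
    rest : ∑[ i < t ] partCountℕ (suc (suc i)) (suc d) ≡ intervalSum B A (sum m)
    rest = trans (sum-cong-≗ (λ i → intervalSum-fin B (A + prefixSum m i) (m i))) (intervalSum-tiling B m A)

  headPartCount-zero : partCountℕ zero 0 ≡ 3
  headPartCount-zero = trans (headPartCount 0)
    (cong (3 +_) (trans (intervalSum-shift _ 3 0 A) (intervalSum-zero _ 0 A (λ _ _ _ → refl))))

  secondPartCount-zero : partCountℕ (suc zero) 0 ≡ 2
  secondPartCount-zero = trans (∑-ones (n (suc zero))) n₁≡2

  zeroClassSize : classSizeℕ 0 ≡ 5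
  zeroClassSize = cong₂ _+_ headPartCount-zero (cong₂ _+_ secondPartCount-zero
    (trans (sum-cong-≗ (λ i → sum-replicate-zero (m i))) (sum-replicate-zero t)))

  zeroColourPart≥2 : ∀ i j → colourℕ (i , j) ≡ 0 → 2 ≤ partCountℕ i 0
  zeroColourPart≥2 zero _ _ = subst (2 ≤_) (sym headPartCount-zero) (s≤s (s≤s z≤n))
  zeroColourPart≥2 (suc zero) _ _ = ≤-reflexive (sym secondPartCount-zero)
  zeroColourPart≥2 (suc (suc i)) _ ()

  relaxed : Relaxed3 n colouring
  relaxed = classSize≤⇒relaxed bound
    where
    bound : ∀ i j → classSize (colouring (i , j)) ≤ 3 + partCount i (colouring (i , j))
    bound i j rewrite classSize≡classSizeℕ (colouring (i , j)) | partCount≡partCountℕ i (colouring (i , j))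
                    | toℕ-colouring (i , j) with colourℕ (i , j) in c≡ | partCountℕ-own i j
    ... | suc d | own = ≤-trans (blockClassSize≤4 d) (+-monoʳ-≤ 3 own)
    ... | zero | _ = subst (_≤ 3 + partCountℕ i 0) (sym zeroClassSize) (+-monoʳ-≤ 3 (zeroColourPart≥2 i j c≡))

  ∑n≡R+5 : ∑[ i < suc (suc t) ] n i ≡ R + 5
  ∑n≡R+5 = trans (cong₂ (λ n₀ n₁ → n₀ + (n₁ + sum m)) n₀≡3+A n₁≡2) (rearrange A (sum m))
    where
    rearrange : ∀ a b → 3 + a + (2 + b) ≡ a + b + 5
    rearrange = solve-∀

  headVertex : Fin 3 → Fin (n zero)
  headVertex x = inject≤ x 3≤n₀

  headVertex-injective : ∀ {x y} → headVertex x ≡ headVertex y → x ≡ y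
  headVertex-injective = inject≤-injective 3≤n₀ 3≤n₀ _ _

  colourℕ-headVertex : ∀ x → colourℕ (zero , headVertex x) ≡ 0
  colourℕ-headVertex x = trans (cong headColour (toℕ-inject≤ x 3≤n₀)) (headColour-Fin3 x)
    where
    headColour-Fin3 : ∀ (x : Fin 3) → headColour (toℕ x) ≡ 0
    headColour-Fin3 zero = refl
    headColour-Fin3 (suc zero) = refl
    headColour-Fin3 (suc (suc zero)) = refl

  colouring-cong : ∀ u v → colourℕ u ≡ colourℕ v → colouring u ≡ colouring v
  colouring-cong u v e = toℕ-injective (trans (toℕ-colouring u) (trans e (sym (toℕ-colouring v))))

lemma5p4 : (t : ℕ) (n : Fin (suc (suc t)) → ℕ) →
    (∀ (i j : Fin (suc (suc t))) → Data.Fin._≤_ i j → n i ≥ n j) →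
    3 ≤ n zero → n zero ≤ 5 → n (suc zero) ≡ 2 →
    Σ ℕ λ k → Σ (Vertex n → Fin k) λ f → Optimal3 n k f ×
      Σ (Fin (n zero)) λ a → Σ (Fin (n zero)) λ b → Σ (Fin (n zero)) λ c →
        ¬ a ≡ b × ¬ a ≡ c × ¬ b ≡ c ×
        f (zero , a) ≡ f (zero , b) × f (zero , a) ≡ f (zero , c) ×
        (∀ (x : Fin (n (suc zero))) → f (suc zero , x) ≡ f (zero , a))
lemma5p4 t n antitone 3≤n₀ n₀≤5 n₁≡2 =
  K , colouring , (relaxed , optimal) ,
  headVertex zero , headVertex (suc zero) , headVertex (suc (suc zero)) ,
  (λ ()) ∘ headVertex-injective , (λ ()) ∘ headVertex-injective , (λ ()) ∘ headVertex-injective ,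
  sameColour zero (suc zero) , sameColour zero (suc (suc zero)) ,
  (λ x → colouring-cong (suc zero , x) _ (sym (colourℕ-headVertex zero)))
  where
  open BlockColouring t n 3≤n₀ n₁≡2
  sameColour : ∀ x y → colouring (zero , headVertex x) ≡ colouring (zero , headVertex y)
  sameColour x y = colouring-cong _ _ (trans (colourℕ-headVertex x) (sym (colourℕ-headVertex y)))
  nₛ≤2 : ∀ i → n (suc i) ≤ 2
  nₛ≤2 i = subst (n (suc i) ≤_) n₁≡2 (antitone (suc zero) (suc i) (s≤s z≤n))
  optimal : ∀ k (g : Vertex n → Fin k) → Relaxed3 n g → K ≤ k
  optimal k g g-relaxed = 3[R+5]≤12k+5⇒1+[R+3]/4≤k R k (subst (λ N → 3 * N ≤ k * 12 + 5) ∑n≡R+5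
    (≤-trans (relaxed-lowerBound n (≤-trans n₀≤5 (ℕ.n≤1+n 5)) nₛ≤2 g g-relaxed) (+-monoʳ-≤ (k * 12) n₀≤5)))
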